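{- Let $pod_2(n)$ be defined by $\sum_{n\ge 0} pod_2(n)q^n = \frac{\psi(-q^2)}{\psi(-q)} = \frac{f_2^2 f_8}{f_1 f_4^2}$. Then: (i) for every positive integer $n$, $pod_2(3n+2)\equiv 0 \pmod 2$; (ii) $\sum_{n=0}^{\infty} pod_2(3n)\,q^n \equiv f_1 \pmod 2$; (iii) $\sum_{n=0}^{\infty} pod_2(9n+1)\,q^n \equiv f_1^3 \pmod 2$.
   Context: For $|q|<1$ and integers $j\ge 1$, $f_j := \prod_{n=1}^{\infty}(1-q^{jn})$. Ramanujan's theta function is $\psi(q) := \sum_{n=0}^{\infty} q^{n(n+1)/2} = f_2^2/f_1$, so that $\psi(-q) = f_1f_4/f_2$. The paper describes $pod_2(n)$ as the number of $2$-regular partitions of $n$ with distinct odd parts (even parts unrestricted), with generating function $\sum_{n\ge0} pod_2(n)q^n = \psi(-q^2)/\psi(-q)$. A congruence between power series in $q$ with integer coefficients modulo $m$ means coefficientwise congruence modulo $m$. -}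

module Defs where

open import Data.Nat using (ℕ; zero; suc; _∸_; _≟_)
open import Data.Integer using (ℤ; +_; -_; _+_; _*_; _-_)
open import Data.List using (List; foldr; map; upTo)
open import Relation.Nullary using (yes; no)

PS : Set
PS = ℕ → ℤ

sumℤ : List ℤ → ℤ
sumℤ = foldr _+_ (+ 0)

infixl 7 _⊛_
_⊛_ : PS → PS → PS
(a ⊛ b) n = sumℤ (map (λ k → a k * b (n ∸ k)) (upTo (suc n)))

one : PS
one zero    = + 1
one (suc _) = + 0

-- The polynomial 1 - q^m  (used with m ≥ 1).
factor : ℕ → PS
factor m zero = + 1
factor m (suc n) with m ≟ suc n
... | yes _ = - (+ 1)
... | no  _ = + 0

partialProd : ℕ → ℕ → PS
partialProd j zero    = one
partialProd j (suc N) = partialProd j N ⊛ factor (j Data.Nat.* suc N)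

-- f_j = ∏_{k≥1} (1 - q^{j k})  (j ≥ 1).  For j ≥ 1 the coefficient of q^n
-- of the infinite product equals that of the finite product over k ≤ n,
-- since the remaining factors are ≡ 1 modulo q^{n+1}.
f : ℕ → PS
f j n = partialProd j n n

_≡[mod_]_ : ℤ → ℕ → ℤ → Set
x ≡[mod m ] y = (+ m) Data.Integer.Divisibility.∣ (x - y)
  where import Data.Integer.Divisibility

{-# OPTIONS --safe #-}
module Submission where

-- Modulo 2 signs disappear and squaring is additive, so f₂ ≡ f₁², f₄ ≡ f₁⁴, f₈ ≡ f₁⁸ and
-- ∑ pod₂(n) qⁿ ≡ f₁¹² / f₁⁹ = f₁³.  Gauss's identity ψ(q) ∏(1 - q^(2i-1)) = ∏(1 - q^(2i)), i.e.
-- ψ f₁ = f₂², turns this into f₁³ ≡ ψ(q) = ∑ q^(k(k+1)/2).  The congruences are then read off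
-- from triangular numbers modulo 3: T(k) is never ≡ 2; T(3j) and T(3j+2) are three times the
-- generalised pentagonal numbers, so the 3n-part of ψ is Euler's pentagonal series ≡ f₁; and
-- T(3j+1) = 9 T(j) + 1, so the (9n+1)-part of ψ is ψ again.
--
-- Euler's and Gauss's identities are proved modulo 2 through Shanks' finite forms, by
-- telescoping in the truncation parameter.  Series live in 𝔽₂[[q]] as Boolean coefficient
-- sequences; an infinite product or sum is the diagonal of its partial products or sums,
-- which stabilise degree by degree.

open import Defs

module PowerSeriesMod2 where

  open import Algebra.Bundles using (CommutativeRing)
  open import Level using (0ℓ)
  open import Relation.Binary.Structures using (IsEquivalence)
  open import Data.Bool using (Bool; true; false; _xor_; _∧_; not)
  open import Data.Bool.Properties
    using ( xor-∧-commutativeRing; xor-comm; xor-assoc; xor-identityˡ; xor-identityʳ; xor-same; ∧-comm; ∧-identityʳ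
          ; not-involutive; not-distribˡ-xor; xor-annihilates-not)
  open import Data.List using (List; []; _∷_; foldr; map; applyUpTo; upTo)
  open import Data.List.Properties using (map-cong; map-∘; map-applyUpTo)
  open import Data.Maybe using (just; nothing)
  open import Data.Nat using (ℕ; zero; suc; _≟_; _∸_; _≤_; _<_; _≤′_; ≤′-refl; ≤′-step; z≤n; s≤s; _≡ᵇ_)
    renaming (_+_ to _+ℕ_; _*_ to _*ℕ_)
  import Data.Nat.Properties as ℕ
  open import Data.Nat.Divisibility using (_∣_; divides)
  open import Data.Integer using (ℤ; +_; -[1+_]; ∣_∣; _⊖_)
    renaming (_+_ to _+ℤ_; _*_ to _*ℤ_; -_ to -ℤ_; _-_ to _-ℤ_)
  import Data.Integer.Properties as ℤ
  open import Data.Nat.DivMod using (_%_; [m+kn]%n≡m%n; m<n⇒m%n≡m)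
  import Data.Nat.Tactic.RingSolver as ℕ-Solver
  open import Data.Product using (_,_)
  open import Data.Sum using (inj₁; inj₂)
  open import Function using (id; _∘_)
  open import Relation.Binary.PropositionalEquality
    using (_≡_; _≢_; refl; sym; trans; cong; cong₂; module ≡-Reasoning)
  open import Relation.Nullary using (yes; no)
  open import Relation.Nullary.Decidable using (dec-true; dec-false)
  open import Tactic.RingSolver using (solve-∀)
  open import Tactic.RingSolver.Core.AlmostCommutativeRing using (AlmostCommutativeRing; fromCommutativeRing)
  import Relation.Binary.Reasoning.Setoid as SetoidReasoning

  -- Recognising false as zero lets the solver drop the `xor false` ending every unfolded product.
  𝔽₂ : AlmostCommutativeRing _ _
  𝔽₂ = fromCommutativeRing xor-∧-commutativeRing λ where
    false → just refl
    true → nothing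

  Series : Set
  Series = ℕ → Bool

  infix 4 _≈_
  record _≈_ (a b : Series) : Set where
    constructor coeffwise
    field at : ∀ n → a n ≡ b n
  open _≈_ public

  infixl 6 _+_
  infixl 7 _*_

  0# 1# : Series
  0# _ = false
  1# zero = true
  1# (suc _) = false

  _+_ : Series → Series → Series
  (a + b) n = a n xor b n

  xorSum : List Bool → Bool
  xorSum = foldr _xor_ false

  -- The Cauchy product ⊛ of Defs read in 𝔽₂.  It unfolds as
  -- (a * b) (suc n) = (a 0 ∧ b (suc n)) xor (tail a * b) n, and the ring laws are proved by
  -- induction along this recursion.
  _*_ : Series → Series → Series
  (a * b) n = xorSum (applyUpTo (λ k → a k ∧ b (n ∸ k)) (suc n))

  tail : Series → Series
  tail a n = a (suc n)

  *-sucʳ : ∀ a b n → (a * b) (suc n) ≡ (a * tail b) n xor (a (suc n) ∧ b 0)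
  *-sucʳ a b zero = rearrange (a 0) (b 1) (a 1) (b 0)
    where
    rearrange : ∀ x y z w → x ∧ y xor (z ∧ w xor false) ≡ (x ∧ y xor false) xor z ∧ w
    rearrange = solve-∀ 𝔽₂
  *-sucʳ a b (suc n) = begin
    x xor (tail a * b) (suc n)                        ≡⟨ cong (x xor_) (*-sucʳ (tail a) b n) ⟩
    x xor ((tail a * tail b) n xor (a (suc (suc n)) ∧ b 0)) ≡⟨ xor-assoc x _ _ ⟨
    (x xor (tail a * tail b) n) xor (a (suc (suc n)) ∧ b 0) ∎
    where
    open ≡-Reasoning
    x = a 0 ∧ b (suc (suc n))

  *-zeroˡ : ∀ b → 0# * b ≈ 0#
  *-zeroˡ b = coeffwise go
    where
    go : ∀ n → (0# * b) n ≡ false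
    go zero = refl
    go (suc n) = go n

  *-identityˡ : ∀ b → 1# * b ≈ b
  *-identityˡ b = coeffwise λ where
    zero → xor-identityʳ (b 0)
    (suc n) → trans (cong (b (suc n) xor_) (at (*-zeroˡ b) n)) (xor-identityʳ (b (suc n)))

  *-comm : ∀ a b → a * b ≈ b * a
  *-comm a b = coeffwise (go a b)
    where
    go : ∀ a b n → (a * b) n ≡ (b * a) n
    go a b zero = cong (_xor false) (∧-comm (a 0) (b 0))
    go a b (suc n) = begin
      (a 0 ∧ b (suc n)) xor (tail a * b) n ≡⟨ cong₂ _xor_ (∧-comm (a 0) (b (suc n))) (go (tail a) b n) ⟩
      (b (suc n) ∧ a 0) xor (b * tail a) n ≡⟨ xor-comm (b (suc n) ∧ a 0) _ ⟩
      (b * tail a) n xor (b (suc n) ∧ a 0) ≡⟨ *-sucʳ b a n ⟨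
      (b * a) (suc n)                      ∎
      where open ≡-Reasoning

  distribʳ : ∀ c a b → (a + b) * c ≈ a * c + b * c
  distribʳ c a b = coeffwise (go a b)
    where
    go : ∀ a b n → ((a + b) * c) n ≡ (a * c) n xor (b * c) n
    go a b zero = distrib (a 0) (b 0) (c 0)
      where
      distrib : ∀ x y z → (x xor y) ∧ z xor false ≡ (x ∧ z xor false) xor (y ∧ z xor false)
      distrib = solve-∀ 𝔽₂
    go a b (suc n) = trans (cong ((a 0 xor b 0) ∧ c (suc n) xor_) (go (tail a) (tail b) n))
                           (distrib (a 0) (b 0) (c (suc n)) ((tail a * c) n) ((tail b * c) n))
      where
      distrib : ∀ x y z u v → (x xor y) ∧ z xor (u xor v) ≡ (x ∧ z xor u) xor (y ∧ z xor v)
      distrib = solve-∀ 𝔽₂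

  scale : Bool → Series → Series
  scale x a n = x ∧ a n

  scale-* : ∀ x a b → scale x a * b ≈ scale x (a * b)
  scale-* x a b = coeffwise (go a)
    where
    go : ∀ a n → (scale x a * b) n ≡ x ∧ (a * b) n
    go a zero = assoc x (a 0) (b 0)
      where
      assoc : ∀ x y z → (x ∧ y) ∧ z xor false ≡ x ∧ (y ∧ z xor false)
      assoc = solve-∀ 𝔽₂
    go a (suc n) = trans (cong ((x ∧ a 0) ∧ b (suc n) xor_) (go (tail a) n)) (assoc x (a 0) (b (suc n)) ((tail a * b) n))
      where
      assoc : ∀ x y z u → (x ∧ y) ∧ z xor x ∧ u ≡ x ∧ (y ∧ z xor u)
      assoc = solve-∀ 𝔽₂

  *-assoc : ∀ a b c → (a * b) * c ≈ a * (b * c)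
  *-assoc a b c = coeffwise (go a)
    where
    go : ∀ a n → ((a * b) * c) n ≡ (a * (b * c)) n
    go a zero = assoc (a 0) (b 0) (c 0)
      where
      assoc : ∀ x y z → (x ∧ y xor false) ∧ z xor false ≡ x ∧ (y ∧ z xor false) xor false
      assoc = solve-∀ 𝔽₂
    go a (suc n) = begin
      x xor (tail (a * b) * c) n
        ≡⟨ cong (x xor_) (at (distribʳ c (scale (a 0) (tail b)) (tail a * b)) n) ⟩
      x xor ((scale (a 0) (tail b) * c) n xor ((tail a * b) * c) n)
        ≡⟨ cong₂ (λ y z → x xor (y xor z)) (at (scale-* (a 0) (tail b) c) n) (go (tail a) n) ⟩
      x xor ((a 0 ∧ (tail b * c) n) xor (tail a * (b * c)) n)
        ≡⟨ assoc (a 0) (b 0) (c (suc n)) ((tail b * c) n) ((tail a * (b * c)) n) ⟩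
      (a 0 ∧ ((b 0 ∧ c (suc n)) xor (tail b * c) n)) xor (tail a * (b * c)) n ∎
      where
      open ≡-Reasoning
      x = (a * b) 0 ∧ c (suc n)
      assoc : ∀ x y z u v → (x ∧ y xor false) ∧ z xor (x ∧ u xor v) ≡ x ∧ (y ∧ z xor u) xor v
      assoc = solve-∀ 𝔽₂

  *-cong : ∀ {a a' b b'} → a ≈ a' → b ≈ b' → a * b ≈ a' * b'
  *-cong {a} {a'} {b} {b'} a≈a' b≈b' = coeffwise (go (at a≈a'))
    where
    go : ∀ {a a'} → (∀ n → a n ≡ a' n) → ∀ n → (a * b) n ≡ (a' * b') n
    go a≡a' zero = cong₂ (λ x y → x ∧ y xor false) (a≡a' 0) (at b≈b' 0)
    go a≡a' (suc n) = cong₂ _xor_ (cong₂ _∧_ (a≡a' 0) (at b≈b' (suc n))) (go (λ k → a≡a' (suc k)) n)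

  +-cong : ∀ {a a' b b'} → a ≈ a' → b ≈ b' → a + b ≈ a' + b'
  +-cong a≈a' b≈b' = coeffwise λ n → cong₂ _xor_ (at a≈a' n) (at b≈b' n)

  +-self : ∀ a → a + a ≈ 0#
  +-self a = coeffwise λ n → xor-same (a n)

  series-commutativeRing : CommutativeRing 0ℓ 0ℓ
  series-commutativeRing = record
    { Carrier = Series
    ; _≈_ = _≈_
    ; _+_ = _+_
    ; _*_ = _*_
    ; -_ = id
    ; 0# = 0#
    ; 1# = 1#
    ; isCommutativeRing = record
      { isRing = record
        { +-isAbelianGroup = record
          { isGroup = record
            { isMonoid = record
              { isSemigroup = record
                { isMagma = record { isEquivalence = ≈-isEquivalence ; ∙-cong = +-cong }
                ; assoc = λ a b c → coeffwise λ n → xor-assoc (a n) (b n) (c n)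
                }
              ; identity = (λ a → coeffwise λ n → xor-identityˡ (a n))
                         , (λ a → coeffwise λ n → xor-identityʳ (a n))
              }
            ; inverse = +-self , +-self
            ; ⁻¹-cong = id
            }
          ; comm = λ a b → coeffwise λ n → xor-comm (a n) (b n)
          }
        ; *-cong = *-cong
        ; *-assoc = *-assoc
        ; *-identity = *-identityˡ , λ a → ≈-trans (*-comm a 1#) (*-identityˡ a)
        ; distrib = (λ c a b → ≈-trans (*-comm c (a + b)) (≈-trans (distribʳ c a b) (+-cong (*-comm a c) (*-comm b c))))
                  , distribʳ
        }
      ; *-comm = *-comm
      }
    }
    where
    ≈-trans : ∀ {a b c} → a ≈ b → b ≈ c → a ≈ c
    ≈-trans a≈b b≈c = coeffwise λ n → trans (at a≈b n) (at b≈c n)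
    ≈-isEquivalence : IsEquivalence _≈_
    ≈-isEquivalence = record
      { refl = coeffwise λ _ → refl
      ; sym = λ a≈b → coeffwise λ n → sym (at a≈b n)
      ; trans = ≈-trans
      }

  open CommutativeRing series-commutativeRing
    using (setoid; *-congˡ; *-congʳ; +-congˡ; +-congʳ; +-assoc; +-identityˡ; +-identityʳ; *-identityʳ; zeroʳ; distribˡ)
    renaming (refl to ≈-refl; sym to ≈-sym; trans to ≈-trans)

  module ≈-Reasoning = SetoidReasoning setoid

  -- The reflective solver cannot be used on series: it folds constants inside the carrier, and
  -- 1# * 1# is not definitionally 1#.
  open import Algebra.Solver.Ring.NaturalCoefficients.Default (CommutativeRing.commutativeSemiring series-commutativeRing)
    using (solve; _:=_; _:+_; _:*_; con)

  +-moveʳ : ∀ {a b c} → a + b ≈ c → a ≈ c + b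
  +-moveʳ {a} {b} {c} a+b≈c = ≈-trans (reassoc a b) (+-congʳ a+b≈c)
    where
    reassoc : ∀ a b → a ≈ (a + b) + b
    reassoc a b = ≈-trans (≈-sym (+-identityʳ a)) (≈-trans (+-congˡ {a} (≈-sym (+-self b))) (≈-sym (+-assoc a b b)))

  frobenius : ∀ a b → (a + b) * (a + b) ≈ a * a + b * b
  frobenius a b = begin
    (a + b) * (a + b)               ≈⟨ expand a b ⟩
    a * a + b * b + (a * b + a * b) ≈⟨ +-congˡ {a * a + b * b} (+-self (a * b)) ⟩
    a * a + b * b + 0#              ≈⟨ +-identityʳ _ ⟩
    a * a + b * b                   ∎
    where
    open ≈-Reasoning
    expand : ∀ a b → (a + b) * (a + b) ≈ a * a + b * b + (a * b + a * b)
    expand = solve 2 (λ a b → (a :+ b) :* (a :+ b) := a :* a :+ b :* b :+ (a :* b :+ a :* b)) ≈-refl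

  q^_ : ℕ → Series
  (q^ e) n = e ≡ᵇ n

  q^-≡ : ∀ {m n} → m ≡ n → q^ m ≈ q^ n
  q^-≡ m≡n = coeffwise λ k → cong (λ e → (q^ e) k) m≡n

  q^0 : q^ 0 ≈ 1#
  q^0 = coeffwise λ where
    zero → refl
    (suc n) → refl

  shift : Series → Series
  shift a zero = false
  shift a (suc n) = a n

  q^-suc-* : ∀ e a → q^ suc e * a ≈ shift (q^ e * a)
  q^-suc-* e a = coeffwise λ where
    zero → refl
    (suc n) → refl

  q^-+ : ∀ m n → q^ (m +ℕ n) ≈ q^ m * q^ n
  q^-+ zero n = ≈-sym (*-identityˡ (q^ n))
  q^-+ (suc m) n = ≈-sym (≈-trans (q^-suc-* m (q^ n)) (coeffwise λ where
    zero → refl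
    (suc k) → at (≈-sym (q^-+ m n)) k))

  q^-low : ∀ {e n} → n < e → (q^ e) n ≡ false
  q^-low {suc e} {zero} _ = refl
  q^-low {suc e} {suc n} (s≤s n<e) = q^-low n<e

  q^-*-low : ∀ {e n} a → n < e → (q^ e * a) n ≡ false
  q^-*-low {suc e} {zero} a _ = refl
  q^-*-low {suc e} {suc n} a (s≤s n<e) = q^-*-low a n<e

  1+q^_ : ℕ → Series
  1+q^ e = 1# + q^ e

  1+q^0≈0 : 1+q^ 0 ≈ 0#
  1+q^0≈0 = ≈-trans (+-congˡ {1#} q^0) (+-self 1#)

  *-1+q^-low : ∀ {E n} a → n < E → (a * 1+q^ E) n ≡ a n
  *-1+q^-low {E} {n} a n<E = begin
    (a * 1+q^ E) n              ≡⟨ at (distribˡ a 1# (q^ E)) n ⟩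
    (a * 1#) n xor (a * q^ E) n ≡⟨ cong₂ _xor_ (at (*-identityʳ a) n) (trans (at (*-comm a (q^ E)) n) (q^-*-low a n<E)) ⟩
    a n xor false               ≡⟨ xor-identityʳ (a n) ⟩
    a n                         ∎
    where open ≡-Reasoning

  infix 4 _≈[≤_]_
  _≈[≤_]_ : Series → ℕ → Series → Set
  a ≈[≤ n ] b = ∀ k → k ≤ n → a k ≡ b k

  *-coeff-cong : ∀ {a a' b b'} n → a ≈[≤ n ] a' → b ≈[≤ n ] b' → (a * b) n ≡ (a' * b') n
  *-coeff-cong zero a≈a' b≈b' = cong₂ (λ x y → x ∧ y xor false) (a≈a' 0 z≤n) (b≈b' 0 z≤n)
  *-coeff-cong (suc n) a≈a' b≈b' =
    cong₂ _xor_ (cong₂ _∧_ (a≈a' 0 z≤n) (b≈b' (suc n) ℕ.≤-refl))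
                (*-coeff-cong n (λ k k≤n → a≈a' (suc k) (s≤s k≤n)) (λ k k≤n → b≈b' k (ℕ.m≤n⇒m≤1+n k≤n)))

  Stable : (ℕ → Series) → Set
  Stable s = ∀ m → s (suc m) ≈[≤ m ] s m

  lim : (ℕ → Series) → Series
  lim s n = s n n

  lim-agrees : ∀ {s} → Stable s → ∀ N → lim s ≈[≤ N ] s N
  lim-agrees {s} stable N n n≤N = sym (go (ℕ.≤⇒≤′ n≤N))
    where
    go : ∀ {N} → n ≤′ N → s N n ≡ s n n
    go ≤′-refl = refl
    go (≤′-step {N} n≤′N) = trans (stable N n (ℕ.≤′⇒≤ n≤′N)) (go n≤′N)

  *-unitʳ≈0⇒≈0 : ∀ {d} u → u 0 ≡ true → d * u ≈ 0# → d ≈ 0#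
  *-unitʳ≈0⇒≈0 {d} u u0≡1 du≈0 = coeffwise λ n → vanishes n n ℕ.≤-refl
    where
    leading : ∀ n → (d * u) (suc n) ≡ (d * tail u) n xor (d (suc n) ∧ true)
    leading n = trans (*-sucʳ d u n) (cong (λ x → (d * tail u) n xor (d (suc n) ∧ x)) u0≡1)
    vanishes : ∀ n → d ≈[≤ n ] 0#
    vanishes zero zero _ = begin
      d 0                    ≡⟨ ∧-identityʳ (d 0) ⟨
      d 0 ∧ true             ≡⟨ xor-identityʳ (d 0 ∧ true) ⟨
      d 0 ∧ true xor false   ≡⟨ cong (λ x → d 0 ∧ x xor false) u0≡1 ⟨
      (d * u) 0              ≡⟨ at du≈0 0 ⟩
      false                  ∎
      where open ≡-Reasoning
    vanishes (suc n) k k≤1+n with ℕ.m≤n⇒m<n∨m≡n k≤1+n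
    ... | inj₁ k<1+n = vanishes n k (ℕ.≤-pred k<1+n)
    ... | inj₂ refl = begin
      d (suc n)                              ≡⟨ ∧-identityʳ (d (suc n)) ⟨
      d (suc n) ∧ true                       ≡⟨ cong (_xor (d (suc n) ∧ true)) lower ⟨
      (d * tail u) n xor (d (suc n) ∧ true)  ≡⟨ leading n ⟨
      (d * u) (suc n)                        ≡⟨ at du≈0 (suc n) ⟩
      false                                  ∎
      where
      open ≡-Reasoning
      lower : (d * tail u) n ≡ false
      lower = trans (*-coeff-cong {d} {0#} {tail u} {tail u} n (vanishes n) (λ _ _ → refl)) (at (*-zeroˡ (tail u)) n)

  *-cancelʳ-unit : ∀ {a b} u → u 0 ≡ true → a * u ≈ b * u → a ≈ b
  *-cancelʳ-unit {a} {b} u u0≡1 au≈bu = ≈-trans (+-moveʳ a+b≈0) (+-identityˡ b)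
    where
    a+b≈0 : a + b ≈ 0#
    a+b≈0 = *-unitʳ≈0⇒≈0 u u0≡1 (≈-trans (distribʳ u a b) (≈-trans (+-congʳ au≈bu) (+-self (b * u))))

  ∑< : ℕ → (ℕ → Series) → Series
  ∑< zero g = 0#
  ∑< (suc N) g = ∑< N g + g N

  syntax ∑< N (λ k → g) = ∑[ k < N ] g

  ∑-+ : ∀ N (g h : ℕ → Series) → ∑[ k < N ] (g k + h k) ≈ ∑< N g + ∑< N h
  ∑-+ zero g h = ≈-sym (+-identityˡ 0#)
  ∑-+ (suc N) g h = ≈-trans (+-congʳ (∑-+ N g h)) (middleFour (∑< N g) (∑< N h) (g N) (h N))
    where
    middleFour : ∀ a b c d → (a + b) + (c + d) ≈ (a + c) + (b + d)
    middleFour = solve 4 (λ a b c d → (a :+ b) :+ (c :+ d) := (a :+ c) :+ (b :+ d)) ≈-refl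

  ∑-*ˡ : ∀ N c (g : ℕ → Series) → c * ∑< N g ≈ ∑[ k < N ] (c * g k)
  ∑-*ˡ zero c g = zeroʳ c
  ∑-*ˡ (suc N) c g = ≈-trans (distribˡ c (∑< N g) (g N)) (+-congʳ (∑-*ˡ N c g))

  ∑-telescope : ∀ N (g h : ℕ → Series) → (∀ k → k < N → g k ≈ h (suc k) + h k) → ∑< N g ≈ h N + h 0
  ∑-telescope zero g h _ = ≈-sym (+-self (h 0))
  ∑-telescope (suc N) g h g≈Δh =
    ≈-trans (+-cong (∑-telescope N g h λ k k<N → g≈Δh k (ℕ.m≤n⇒m≤1+n k<N)) (g≈Δh N ℕ.≤-refl))
            (cancel (h N) (h 0) (h (suc N)))
    where
    cancel : ∀ x y z → (x + y) + (z + x) ≈ z + y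
    cancel x y z = ≈-trans (rearrange x y z) (≈-trans (+-congʳ (+-congʳ (+-self x))) (+-congʳ (+-identityˡ z)))
      where
      rearrange : ∀ x y z → (x + y) + (z + x) ≈ ((x + x) + z) + y
      rearrange = solve 3 (λ x y z → (x :+ y) :+ (z :+ x) := ((x :+ x) :+ z) :+ y) ≈-refl

  ∑-telescope-step : ∀ (t : ℕ → ℕ → Series) c (h : ℕ → Series) m → h 0 ≈ 0#
    → (∀ k → k ≤ m → t (suc m) k + c * t m k ≈ h (suc k) + h k)
    → ∑[ k < suc (suc m) ] t (suc m) k + c * ∑[ k < suc m ] t m k ≈ h (suc m) + t (suc m) (suc m)
  ∑-telescope-step t c h m h0≈0 step = begin
    (∑< (suc m) (t (suc m)) + t (suc m) (suc m)) + c * ∑< (suc m) (t m)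
      ≈⟨ swap (∑< (suc m) (t (suc m))) (t (suc m) (suc m)) (c * ∑< (suc m) (t m)) ⟩
    (∑< (suc m) (t (suc m)) + c * ∑< (suc m) (t m)) + t (suc m) (suc m)
      ≈⟨ +-congʳ (+-congˡ {∑< (suc m) (t (suc m))} (∑-*ˡ (suc m) c (t m))) ⟩
    (∑< (suc m) (t (suc m)) + ∑[ k < suc m ] (c * t m k)) + t (suc m) (suc m)
      ≈⟨ +-congʳ (∑-+ (suc m) (t (suc m)) (λ k → c * t m k)) ⟨
    ∑[ k < suc m ] (t (suc m) k + c * t m k) + t (suc m) (suc m)
      ≈⟨ +-congʳ (∑-telescope (suc m) _ h λ k k<1+m → step k (ℕ.≤-pred k<1+m)) ⟩
    (h (suc m) + h 0) + t (suc m) (suc m)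
      ≈⟨ +-congʳ (≈-trans (+-congˡ {h (suc m)} h0≈0) (+-identityʳ (h (suc m)))) ⟩
    h (suc m) + t (suc m) (suc m) ∎
    where
    open ≈-Reasoning
    swap : ∀ a b c → (a + b) + c ≈ (a + c) + b
    swap = solve 3 (λ a b c → (a :+ b) :+ c := (a :+ c) :+ b) ≈-refl

  ∑-≈[≤]-head : ∀ N n (g : ℕ → Series) → (∀ k → g (suc k) ≈[≤ n ] 0#) → ∑[ k < suc N ] g k ≈[≤ n ] g 0
  ∑-≈[≤]-head zero n g _ k _ = refl
  ∑-≈[≤]-head (suc N) n g tail≈0 k k≤n =
    trans (cong₂ _xor_ (∑-≈[≤]-head N n g tail≈0 k k≤n) (tail≈0 N k k≤n)) (xor-identityʳ (g 0 k))

  ∑-dissect₃ : ∀ N (g : ℕ → Series)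
    → ∑[ k < 3 *ℕ N ] g k ≈ ∑[ j < N ] g (3 *ℕ j) + ∑[ j < N ] g (3 *ℕ j +ℕ 1) + ∑[ j < N ] g (3 *ℕ j +ℕ 2)
  ∑-dissect₃ zero g = ≈-sym (≈-trans (+-identityʳ (0# + 0#)) (+-identityʳ 0#))
  ∑-dissect₃ (suc N) g = begin
    ∑< (3 *ℕ suc N) g
      ≡⟨ cong (λ i → ∑< i g) (ℕ.*-suc 3 N) ⟩
    ((∑< (3 *ℕ N) g + g (3 *ℕ N)) + g (1 +ℕ 3 *ℕ N)) + g (2 +ℕ 3 *ℕ N)
      ≡⟨ cong₂ (λ i i' → ((∑< (3 *ℕ N) g + g (3 *ℕ N)) + g i) + g i')
               (ℕ.+-comm 1 (3 *ℕ N)) (ℕ.+-comm 2 (3 *ℕ N)) ⟩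
    ((∑< (3 *ℕ N) g + g (3 *ℕ N)) + g (3 *ℕ N +ℕ 1)) + g (3 *ℕ N +ℕ 2)
      ≈⟨ +-congʳ (+-congʳ (+-congʳ (∑-dissect₃ N g))) ⟩
    (((S₀ + S₁ + S₂) + g (3 *ℕ N)) + g (3 *ℕ N +ℕ 1)) + g (3 *ℕ N +ℕ 2)
      ≈⟨ regroup S₀ S₁ S₂ (g (3 *ℕ N)) (g (3 *ℕ N +ℕ 1)) (g (3 *ℕ N +ℕ 2)) ⟩
    (S₀ + g (3 *ℕ N)) + (S₁ + g (3 *ℕ N +ℕ 1)) + (S₂ + g (3 *ℕ N +ℕ 2)) ∎
    where
    open ≈-Reasoning
    S₀ = ∑[ j < N ] g (3 *ℕ j)
    S₁ = ∑[ j < N ] g (3 *ℕ j +ℕ 1)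
    S₂ = ∑[ j < N ] g (3 *ℕ j +ℕ 2)
    regroup : ∀ a b c x y z → (((a + b + c) + x) + y) + z ≈ (a + x) + (b + y) + (c + z)
    regroup = solve 6 (λ a b c x y z → (((a :+ b :+ c) :+ x) :+ y) :+ z := (a :+ x) :+ (b :+ y) :+ (c :+ z)) ≈-refl

  Inflationary : (ℕ → ℕ) → Set
  Inflationary e = ∀ k → k ≤ e k

  ∑q^_ : (ℕ → ℕ) → Series
  ∑q^ e = lim (λ N → ∑[ k < suc N ] q^ e k)

  ∑q^-agrees : ∀ {e} → Inflationary e → ∀ N → ∑q^ e ≈[≤ N ] ∑[ k < suc N ] q^ e k
  ∑q^-agrees {e} infl = lim-agrees λ m k k≤m →
    trans (cong ((∑[ i < suc m ] q^ e i) k xor_) (q^-low (ℕ.≤-trans (s≤s k≤m) (infl (suc m)))))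
          (xor-identityʳ _)

  ∑q^-coeff : ∀ {e n N} → Inflationary e → n < N → (∑q^ e) n ≡ (∑[ k < N ] q^ e k) n
  ∑q^-coeff {N = suc N} infl (s≤s n≤N) = ∑q^-agrees infl N _ n≤N

  ≡ᵇ-true : ∀ {m n} → m ≡ n → (m ≡ᵇ n) ≡ true
  ≡ᵇ-true {m} {n} = dec-true (m ≟ n)

  ≡ᵇ-false : ∀ {m n} → m ≢ n → (m ≡ᵇ n) ≡ false
  ≡ᵇ-false {m} {n} = dec-false (m ≟ n)

  ≡ᵇ-cong : ∀ {m n m' n'} → (m ≡ n → m' ≡ n') → (m' ≡ n' → m ≡ n) → (m ≡ᵇ n) ≡ (m' ≡ᵇ n')
  ≡ᵇ-cong {m} {n} to from with m ≟ n
  ... | yes m≡n = trans (≡ᵇ-true m≡n) (sym (≡ᵇ-true (to m≡n)))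
  ... | no m≢n = trans (≡ᵇ-false m≢n) (sym (≡ᵇ-false (m≢n ∘ from)))

  ≡ᵇ-injective : ∀ (h : ℕ → ℕ) → (∀ {a b} → h a ≡ h b → a ≡ b)
    → ∀ {x a} n → x ≡ h a → (x ≡ᵇ h n) ≡ (a ≡ᵇ n)
  ≡ᵇ-injective h h-injective n x≡ha =
    ≡ᵇ-cong (λ x≡hn → h-injective (trans (sym x≡ha) x≡hn)) (λ a≡n → trans x≡ha (cong h a≡n))

  ∑q^-coeff-cong : ∀ N {e e' : ℕ → ℕ} {n n'} → (∀ j → (e j ≡ᵇ n) ≡ (e' j ≡ᵇ n'))
    → (∑[ j < N ] q^ e j) n ≡ (∑[ j < N ] q^ e' j) n'
  ∑q^-coeff-cong zero _ = refl
  ∑q^-coeff-cong (suc N) {e} {e'} same = cong₂ _xor_ (∑q^-coeff-cong N {e} {e'} same) (same N)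

  ∑q^-coeff-absent : ∀ N {e : ℕ → ℕ} {n} → (∀ j → e j ≢ n) → (∑[ j < N ] q^ e j) n ≡ false
  ∑q^-coeff-absent zero _ = refl
  ∑q^-coeff-absent (suc N) {e} absent = cong₂ _xor_ (∑q^-coeff-absent N {e} absent) (≡ᵇ-false (absent N))

  -- prodFrom e k d = ∏_{k < i ≤ k + d} (1 + q^(e i)) and prodBetween e k m = ∏_{k < i ≤ m}, which
  -- is empty for m ≤ k.  Infinite products start at i = 1, whereas ∑q^ e sums from k = 0.
  prodFrom : (ℕ → ℕ) → ℕ → ℕ → Series
  prodFrom e k zero = 1#
  prodFrom e k (suc d) = prodFrom e k d * 1+q^ e (suc (k +ℕ d))

  1+q^-cong : ∀ (e : ℕ → ℕ) {i i'} → i ≡ i' → 1+q^ e (suc i) ≈ 1+q^ e (suc i')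
  1+q^-cong e i≡i' = coeffwise λ n → cong (λ i → (1+q^ e (suc i)) n) i≡i'

  prodBetween : (ℕ → ℕ) → ℕ → ℕ → Series
  prodBetween e k m = prodFrom e k (m ∸ k)

  prodUpTo : (ℕ → ℕ) → ℕ → Series
  prodUpTo e = prodFrom e 0

  prodFrom-cons : ∀ e k d → prodFrom e k (suc d) ≈ 1+q^ e (suc k) * prodFrom e (suc k) d
  prodFrom-cons e k zero =
    ≈-trans (*-identityˡ (1+q^ e (suc (k +ℕ 0))))
      (≈-trans (1+q^-cong e (ℕ.+-identityʳ k)) (≈-sym (*-identityʳ (1+q^ e (suc k)))))
  prodFrom-cons e k (suc d) = begin
    prodFrom e k (suc d) * 1+q^ e (suc (k +ℕ suc d))
      ≈⟨ *-cong (prodFrom-cons e k d) (1+q^-cong e (ℕ.+-suc k d)) ⟩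
    (1+q^ e (suc k) * prodFrom e (suc k) d) * 1+q^ e (suc (suc k +ℕ d))
      ≈⟨ *-assoc (1+q^ e (suc k)) (prodFrom e (suc k) d) (1+q^ e (suc (suc k +ℕ d))) ⟩
    1+q^ e (suc k) * prodFrom e (suc k) (suc d) ∎
    where open ≈-Reasoning

  prodBetween-snoc : ∀ e {k m} → k ≤ m → prodBetween e k (suc m) ≈ prodBetween e k m * 1+q^ e (suc m)
  prodBetween-snoc e {k} {m} k≤m rewrite ℕ.+-∸-assoc 1 k≤m =
    *-congˡ {prodBetween e k m} (1+q^-cong e (ℕ.m+[n∸m]≡n k≤m))

  prodBetween-cons : ∀ e {k m} → k < m → prodBetween e k m ≈ 1+q^ e (suc k) * prodBetween e (suc k) m
  prodBetween-cons e {k} {m} k<m rewrite ℕ.+-∸-assoc 1 k<m = prodFrom-cons e k (m ∸ suc k)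

  prodBetween-self : ∀ e m → prodBetween e m m ≈ 1#
  prodBetween-self e m rewrite ℕ.n∸n≡0 m = ≈-refl

  *-prodBetween-self : ∀ a e m → a * prodBetween e m m ≈ a
  *-prodBetween-self a e m = ≈-trans (*-congˡ {a} (prodBetween-self e m)) (*-identityʳ a)

  prodUpTo-stable : ∀ {e} → Inflationary e → Stable (prodUpTo e)
  prodUpTo-stable {e} infl m k k≤m = *-1+q^-low (prodUpTo e m) (ℕ.≤-trans (s≤s k≤m) (infl (suc m)))

  ∏1+q^_ : (ℕ → ℕ) → Series
  ∏1+q^ e = lim (prodUpTo e)

  ∏-agrees : ∀ {e} → Inflationary e → ∀ N → ∏1+q^ e ≈[≤ N ] prodUpTo e N
  ∏-agrees infl = lim-agrees (prodUpTo-stable infl)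

  prodUpTo-cong : ∀ {e e'} → (∀ i → e i ≡ e' i) → ∀ N → prodUpTo e N ≈ prodUpTo e' N
  prodUpTo-cong e≡e' zero = ≈-refl
  prodUpTo-cong e≡e' (suc N) = *-cong (prodUpTo-cong e≡e' N) (coeffwise λ n → cong (λ i → (1+q^ i) n) (e≡e' (suc N)))

  ∏-cong : ∀ {e e'} → (∀ i → e i ≡ e' i) → ∏1+q^ e ≈ ∏1+q^ e'
  ∏-cong e≡e' = coeffwise λ n → at (prodUpTo-cong e≡e' n) n

  1+q^-double : ∀ E → 1+q^ (E +ℕ E) ≈ 1+q^ E * 1+q^ E
  1+q^-double E = begin
    1# + q^ (E +ℕ E)      ≈⟨ +-cong (≈-sym (*-identityˡ 1#)) (q^-+ E E) ⟩
    1# * 1# + q^ E * q^ E ≈⟨ frobenius 1# (q^ E) ⟨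
    1+q^ E * 1+q^ E       ∎
    where open ≈-Reasoning

  prodUpTo-double : ∀ e N → prodUpTo (λ i → e i +ℕ e i) N ≈ prodUpTo e N * prodUpTo e N
  prodUpTo-double e zero = ≈-sym (*-identityˡ 1#)
  prodUpTo-double e (suc N) = begin
    prodUpTo (λ i → e i +ℕ e i) N * 1+q^ (e (suc N) +ℕ e (suc N))
      ≈⟨ *-cong (prodUpTo-double e N) (1+q^-double (e (suc N))) ⟩
    (prodUpTo e N * prodUpTo e N) * (1+q^ e (suc N) * 1+q^ e (suc N))
      ≈⟨ middleFour (prodUpTo e N) (prodUpTo e N) (1+q^ e (suc N)) (1+q^ e (suc N)) ⟩
    prodUpTo e (suc N) * prodUpTo e (suc N) ∎
    where
    open ≈-Reasoning
    middleFour : ∀ a b c d → (a * b) * (c * d) ≈ (a * c) * (b * d)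
    middleFour = solve 4 (λ a b c d → (a :* b) :* (c :* d) := (a :* c) :* (b :* d)) ≈-refl

  ∏-double : ∀ {e} → Inflationary e → ∏1+q^ (λ i → e i +ℕ e i) ≈ ∏1+q^ e * ∏1+q^ e
  ∏-double {e} infl = coeffwise λ n →
    trans (at (prodUpTo-double e n) n) (sym (*-coeff-cong n (∏-agrees infl n) (∏-agrees infl n)))

  oddNumber : ℕ → ℕ
  oddNumber zero = zero
  oddNumber (suc i) = suc (i +ℕ i)

  evenNumber : ℕ → ℕ
  evenNumber i = i +ℕ i

  id-inflationary : Inflationary id
  id-inflationary k = ℕ.≤-refl

  oddNumber-inflationary : Inflationary oddNumber
  oddNumber-inflationary zero = z≤n
  oddNumber-inflationary (suc i) = s≤s (ℕ.m≤m+n i i)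

  evenNumber-inflationary : Inflationary evenNumber
  evenNumber-inflationary i = ℕ.m≤m+n i i

  prodUpTo-split : ∀ N → prodUpTo id (N +ℕ N) ≈ prodUpTo oddNumber N * prodUpTo evenNumber N
  prodUpTo-split zero = ≈-sym (*-identityˡ 1#)
  prodUpTo-split (suc N) = begin
    prodUpTo id (suc N +ℕ suc N)
      ≡⟨ cong (λ i → prodUpTo id (suc i)) (ℕ.+-suc N N) ⟩
    (prodUpTo id (N +ℕ N) * 1+q^ suc (N +ℕ N)) * 1+q^ suc (suc (N +ℕ N))
      ≈⟨ *-congʳ (*-congʳ (prodUpTo-split N)) ⟩
    ((prodUpTo oddNumber N * prodUpTo evenNumber N) * 1+q^ suc (N +ℕ N)) * 1+q^ suc (suc (N +ℕ N))
      ≈⟨ regroup (prodUpTo oddNumber N) (prodUpTo evenNumber N) (1+q^ suc (N +ℕ N)) (1+q^ suc (suc (N +ℕ N))) ⟩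
    prodUpTo oddNumber (suc N) * (prodUpTo evenNumber N * 1+q^ suc (suc (N +ℕ N)))
      ≈⟨ *-congˡ {prodUpTo oddNumber (suc N)} (*-congˡ {prodUpTo evenNumber N} (1+q^-cong id (sym (ℕ.+-suc N N)))) ⟩
    prodUpTo oddNumber (suc N) * prodUpTo evenNumber (suc N) ∎
    where
    open ≈-Reasoning
    regroup : ∀ a b c d → ((a * b) * c) * d ≈ (a * c) * (b * d)
    regroup = solve 4 (λ a b c d → ((a :* b) :* c) :* d := (a :* c) :* (b :* d)) ≈-refl

  ∏-split : ∏1+q^ id ≈ ∏1+q^ oddNumber * ∏1+q^ evenNumber
  ∏-split = coeffwise λ n → begin
    (∏1+q^ id) n                                      ≡⟨ ∏-agrees id-inflationary (n +ℕ n) n (ℕ.m≤m+n n n) ⟩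
    prodUpTo id (n +ℕ n) n                            ≡⟨ at (prodUpTo-split n) n ⟩
    (prodUpTo oddNumber n * prodUpTo evenNumber n) n  ≡⟨ *-coeff-cong n (∏-agrees oddNumber-inflationary n)
                                                                         (∏-agrees evenNumber-inflationary n) ⟨
    (∏1+q^ oddNumber * ∏1+q^ evenNumber) n            ∎
    where open ≡-Reasoning

  tri : ℕ → ℕ
  tri zero = zero
  tri (suc k) = tri k +ℕ suc k

  tri-inflationary : Inflationary tri
  tri-inflationary zero = z≤n
  tri-inflationary (suc k) = ℕ.m≤n+m (suc k) (tri k)

  tri-double : ∀ k → tri k +ℕ tri k ≡ k *ℕ suc k
  tri-double zero = refl
  tri-double (suc k) = begin
    (tri k +ℕ suc k) +ℕ (tri k +ℕ suc k) ≡⟨ regroup (tri k) k ⟩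
    (tri k +ℕ tri k) +ℕ 2 *ℕ suc k       ≡⟨ cong (_+ℕ 2 *ℕ suc k) (tri-double k) ⟩
    k *ℕ suc k +ℕ 2 *ℕ suc k             ≡⟨ collect k ⟩
    suc k *ℕ suc (suc k)                 ∎
    where
    open ≡-Reasoning
    regroup : ∀ t k → (t +ℕ suc k) +ℕ (t +ℕ suc k) ≡ (t +ℕ t) +ℕ 2 *ℕ suc k
    regroup = ℕ-Solver.solve-∀
    collect : ∀ k → k *ℕ suc k +ℕ 2 *ℕ suc k ≡ suc k *ℕ suc (suc k)
    collect = ℕ-Solver.solve-∀

  tri-unique : ∀ k v → v +ℕ v ≡ k *ℕ suc k → tri k ≡ v
  tri-unique k v 2v≡k[k+1] = ℕ.*-cancelˡ-≡ (tri k) v 2 (begin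
    2 *ℕ tri k        ≡⟨ cong (tri k +ℕ_) (ℕ.+-identityʳ (tri k)) ⟩
    tri k +ℕ tri k    ≡⟨ trans (tri-double k) (sym 2v≡k[k+1]) ⟩
    v +ℕ v            ≡⟨ cong (v +ℕ_) (ℕ.+-identityʳ v) ⟨
    2 *ℕ v            ∎)
    where open ≡-Reasoning

  -- j(3j+1)/2 and (j+1)(3j+2)/2: together the generalised pentagonal numbers.
  pentagonal⁺ pentagonal⁻ : ℕ → ℕ
  pentagonal⁺ j = j *ℕ j +ℕ tri j
  pentagonal⁻ j = j *ℕ suc j +ℕ tri (suc j)

  -- Euler's pentagonal number theorem modulo 2

  -- Shanks: ∑_{k ≤ m} q^(mk + T k) ∏_{k < i ≤ m} (1 + q^i) equals the pentagonal sum below, and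
  -- agrees with ∏_{i ≤ m} (1 + q^i) up to degree m.
  pentagonalSum : ℕ → Series
  pentagonalSum m = ∑[ j < suc m ] q^ pentagonal⁺ j + ∑[ j < m ] q^ pentagonal⁻ j

  eulerTerm : ℕ → ℕ → Series
  eulerTerm m k = q^ (m *ℕ k +ℕ tri k) * prodBetween id k m

  eulerSum : ℕ → Series
  eulerSum m = ∑[ k < suc m ] eulerTerm m k

  eulerCorrection : ℕ → ℕ → Series
  eulerCorrection m zero = 0#
  eulerCorrection m (suc k) = q^ (m *ℕ suc k +ℕ tri (suc k)) * prodBetween id k m

  eulerCorrection-closed : ∀ {m k} → k ≤ m → eulerCorrection m k ≈ q^ (m *ℕ k +ℕ tri k) * (1+q^ k * prodBetween id k m)
  eulerCorrection-closed {m} {zero} _ = ≈-sym (begin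
    A * (1+q^ 0 * B) ≈⟨ *-congˡ {A} (*-congʳ {B} 1+q^0≈0) ⟩
    A * (0# * B)     ≈⟨ *-congˡ {A} (*-zeroˡ B) ⟩
    A * 0#           ≈⟨ zeroʳ A ⟩
    0#               ∎)
    where
    open ≈-Reasoning
    A = q^ (m *ℕ 0 +ℕ 0)
    B = prodBetween id 0 m
  eulerCorrection-closed {m} {suc k} k<m = *-congˡ {q^ (m *ℕ suc k +ℕ tri (suc k))} (prodBetween-cons id k<m)

  eulerTerm-step : ∀ {m k} → k ≤ m
    → eulerTerm (suc m) k + eulerTerm m k ≈ eulerCorrection m (suc k) + eulerCorrection m k
  eulerTerm-step {m} {k} k≤m = begin
    eulerTerm (suc m) k + eulerTerm m k
      ≈⟨ +-congʳ (*-cong (≈-trans (q^-≡ (shiftExponent m k (tri k))) (q^-+ E k)) (prodBetween-snoc id k≤m)) ⟩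
    (A * q^ k) * (B * 1+q^ suc m) + A * B
      ≈⟨ identity A (q^ k) (q^ suc m) B ⟩
    ((A * q^ k) * q^ suc m) * B + A * (1+q^ k * B)
      ≈⟨ +-cong (*-congʳ (≈-sym (≈-trans (q^-≡ (correctionExponent m k (tri k)))
                                          (≈-trans (q^-+ (E +ℕ k) (suc m)) (*-congʳ (q^-+ E k))))))
                (≈-sym (eulerCorrection-closed k≤m)) ⟩
    eulerCorrection m (suc k) + eulerCorrection m k ∎
    where
    open ≈-Reasoning
    E = m *ℕ k +ℕ tri k
    A = q^ E
    B = prodBetween id k m
    shiftExponent : ∀ m k t → suc m *ℕ k +ℕ t ≡ (m *ℕ k +ℕ t) +ℕ k
    shiftExponent = ℕ-Solver.solve-∀
    correctionExponent : ∀ m k t → m *ℕ suc k +ℕ (t +ℕ suc k) ≡ ((m *ℕ k +ℕ t) +ℕ k) +ℕ suc m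
    correctionExponent = ℕ-Solver.solve-∀
    identity : ∀ a x c b → (a * x) * (b * (1# + c)) + a * b ≈ ((a * x) * c) * b + a * ((1# + x) * b)
    identity = solve 4 (λ a x c b → (a :* x) :* (b :* (con 1 :+ c)) :+ a :* b
                                    := ((a :* x) :* c) :* b :+ a :* ((con 1 :+ x) :* b)) ≈-refl

  eulerSum≈pentagonalSum : ∀ m → eulerSum m ≈ pentagonalSum m
  eulerSum≈pentagonalSum zero = begin
    0# + q^ 0 * 1#       ≈⟨ +-congˡ {0#} (*-identityʳ (q^ 0)) ⟩
    0# + q^ 0            ≈⟨ +-identityʳ (0# + q^ 0) ⟨
    (0# + q^ 0) + 0#     ∎
    where open ≈-Reasoning
  eulerSum≈pentagonalSum (suc m) = begin
    eulerSum (suc m)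
      ≈⟨ +-moveʳ telescoped ⟩
    (eulerCorrection m (suc m) + eulerTerm (suc m) (suc m)) + eulerSum m
      ≈⟨ +-cong (+-cong (*-prodBetween-self (q^ pentagonal⁻ m) id m) (*-prodBetween-self (q^ pentagonal⁺ (suc m)) id (suc m)))
                (eulerSum≈pentagonalSum m) ⟩
    (q^ pentagonal⁻ m + q^ pentagonal⁺ (suc m)) + pentagonalSum m
      ≈⟨ rearrange (q^ pentagonal⁻ m) (q^ pentagonal⁺ (suc m))
                   (∑[ j < suc m ] q^ pentagonal⁺ j) (∑[ j < m ] q^ pentagonal⁻ j) ⟩
    pentagonalSum (suc m) ∎
    where
    open ≈-Reasoning
    telescoped : eulerSum (suc m) + eulerSum m ≈ eulerCorrection m (suc m) + eulerTerm (suc m) (suc m)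
    telescoped = ≈-trans (+-congˡ {eulerSum (suc m)} (≈-sym (*-identityˡ (eulerSum m))))
      (∑-telescope-step eulerTerm 1# (eulerCorrection m) m ≈-refl λ k k≤m →
         ≈-trans (+-congˡ {eulerTerm (suc m) k} (*-identityˡ (eulerTerm m k))) (eulerTerm-step k≤m))
    rearrange : ∀ x y p n → (x + y) + (p + n) ≈ (p + y) + (n + x)
    rearrange = solve 4 (λ x y p n → (x :+ y) :+ (p :+ n) := (p :+ y) :+ (n :+ x)) ≈-refl

  eulerSum≈[≤]prodUpTo : ∀ m → eulerSum m ≈[≤ m ] prodUpTo id m
  eulerSum≈[≤]prodUpTo m k k≤m = trans (∑-≈[≤]-head m m (eulerTerm m) higherTerms k k≤m) (at firstTerm k)
    where
    higherTerms : ∀ j → eulerTerm m (suc j) ≈[≤ m ] 0#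
    higherTerms j i i≤m = q^-*-low (prodBetween id (suc j) m)
      (ℕ.≤-<-trans (ℕ.≤-trans i≤m (ℕ.m≤m*n m (suc j)))
                   (ℕ.m<m+n (m *ℕ suc j) (ℕ.≤-trans (s≤s z≤n) (ℕ.m≤n+m (suc j) (tri j)))))
    firstTerm : eulerTerm m 0 ≈ prodUpTo id m
    firstTerm = ≈-trans (*-congʳ (≈-trans (q^-≡ (cong (_+ℕ 0) (ℕ.*-zeroʳ m))) q^0)) (*-identityˡ (prodUpTo id m))

  euler : ∏1+q^ id ≈ ∑q^ pentagonal⁺ + ∑q^ pentagonal⁻
  euler = coeffwise λ n → begin
    (∏1+q^ id) n        ≡⟨ eulerSum≈[≤]prodUpTo n n ℕ.≤-refl ⟨
    eulerSum n n        ≡⟨ at (eulerSum≈pentagonalSum n) n ⟩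
    pentagonalSum n n   ≡⟨ cong ((∑q^ pentagonal⁺) n xor_) (lastTermVanishes n) ⟩
    (∑q^ pentagonal⁺ + ∑q^ pentagonal⁻) n ∎
    where
    open ≡-Reasoning
    lastTermVanishes : ∀ n → (∑[ j < n ] q^ pentagonal⁻ j) n ≡ (∑q^ pentagonal⁻) n
    lastTermVanishes n = sym (trans (cong ((∑[ j < n ] q^ pentagonal⁻ j) n xor_) (q^-low n<pentagonal⁻n))
                                    (xor-identityʳ _))
      where
      n<pentagonal⁻n : n < pentagonal⁻ n
      n<pentagonal⁻n = ℕ.≤-trans (ℕ.m≤n+m (suc n) (tri n)) (ℕ.m≤n+m (tri (suc n)) (n *ℕ suc n))

  -- Gauss's triangular number identity modulo 2

  -- Shanks: ∑_{j ≤ m} q^(j(2m+1)) ∏_{i ≤ j} (1 + q^(2i-1)) ∏_{j < i ≤ m} (1 + q^(2i))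
  -- = ∏_{i ≤ m} (1 + q^(2i-1)) ∑_{k ≤ 2m} q^(T k), and the left side agrees with
  -- ∏_{i ≤ m} (1 + q^(2i)) up to degree 2m.
  triangularSum : ℕ → Series
  triangularSum m = ∑[ k < suc (m +ℕ m) ] q^ tri k

  triangularSum-suc : ∀ m → triangularSum (suc m) ≡ (triangularSum m + q^ tri (suc (m +ℕ m))) + q^ tri (suc (suc (m +ℕ m)))
  triangularSum-suc m = cong (λ i → ∑[ k < suc (suc i) ] q^ tri k) (ℕ.+-suc m m)

  gaussTerm : ℕ → ℕ → Series
  gaussTerm m j = q^ (j *ℕ suc (m +ℕ m)) * (prodUpTo oddNumber j * prodBetween evenNumber j m)

  gaussSum : ℕ → Series
  gaussSum m = ∑[ j < suc m ] gaussTerm m j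

  gaussCorrection : ℕ → ℕ → Series
  gaussCorrection m zero = 0#
  gaussCorrection m (suc j) = q^ (suc j *ℕ suc (m +ℕ m)) * (prodUpTo oddNumber (suc j) * prodBetween evenNumber j m)

  gaussCorrection-closed : ∀ {m j} → j ≤ m
    → gaussCorrection m j ≈ q^ (j *ℕ suc (m +ℕ m)) * (prodUpTo oddNumber j * (1+q^ (j +ℕ j) * prodBetween evenNumber j m))
  gaussCorrection-closed {m} {zero} _ = ≈-sym (begin
    q^ 0 * (1# * (1+q^ 0 * B)) ≈⟨ *-congˡ {q^ 0} (*-congˡ {1#} (*-congʳ {B} 1+q^0≈0)) ⟩
    q^ 0 * (1# * (0# * B))     ≈⟨ *-congˡ {q^ 0} (*-congˡ {1#} (*-zeroˡ B)) ⟩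
    q^ 0 * (1# * 0#)           ≈⟨ *-congˡ {q^ 0} (zeroʳ 1#) ⟩
    q^ 0 * 0#                  ≈⟨ zeroʳ (q^ 0) ⟩
    0#                         ∎)
    where
    open ≈-Reasoning
    B = prodBetween evenNumber 0 m
  gaussCorrection-closed {m} {suc j} j<m =
    *-congˡ {q^ (suc j *ℕ suc (m +ℕ m))} (*-congˡ {prodUpTo oddNumber (suc j)} (prodBetween-cons evenNumber j<m))

  gaussTerm-step : ∀ {m j} → j ≤ m
    → gaussTerm (suc m) j + 1+q^ suc (m +ℕ m) * gaussTerm m j ≈ gaussCorrection m (suc j) + gaussCorrection m j
  gaussTerm-step {m} {j} j≤m = begin
    gaussTerm (suc m) j + 1+q^ suc (m +ℕ m) * gaussTerm m j
      ≈⟨ +-congʳ (*-cong (≈-trans (q^-≡ (termExponent j m)) (q^-+ (j *ℕ suc (m +ℕ m)) (j +ℕ j)))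
                         (*-congˡ {O} (≈-trans (prodBetween-snoc evenNumber j≤m)
                                               (*-congˡ {B} (+-congˡ {1#} (≈-trans (q^-≡ (evenExponent m)) (q^-+ (suc (m +ℕ m)) 1))))))) ⟩
    (A * D) * (O * (B * (1# + C * x))) + (1# + C) * (A * (O * B))
      ≈⟨ identity A D O B C x ⟩
    (A * C) * ((O * (1# + D * x)) * B) + A * (O * ((1# + D) * B))
      ≈⟨ +-cong (≈-sym (*-cong (≈-trans (q^-≡ (correctionExponent j m)) (q^-+ (j *ℕ suc (m +ℕ m)) (suc (m +ℕ m))))
                               (*-congʳ {B} (*-congˡ {O} (+-congˡ {1#} (≈-trans (q^-≡ (ℕ.+-comm 1 (j +ℕ j))) (q^-+ (j +ℕ j) 1)))))))
                (≈-sym (gaussCorrection-closed j≤m)) ⟩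
    gaussCorrection m (suc j) + gaussCorrection m j ∎
    where
    open ≈-Reasoning
    A = q^ (j *ℕ suc (m +ℕ m))
    D = q^ (j +ℕ j)
    O = prodUpTo oddNumber j
    B = prodBetween evenNumber j m
    C = q^ suc (m +ℕ m)
    x = q^ 1
    termExponent : ∀ j m → j *ℕ suc (suc m +ℕ suc m) ≡ j *ℕ suc (m +ℕ m) +ℕ (j +ℕ j)
    termExponent = ℕ-Solver.solve-∀
    evenExponent : ∀ m → suc m +ℕ suc m ≡ suc (m +ℕ m) +ℕ 1
    evenExponent = ℕ-Solver.solve-∀
    correctionExponent : ∀ j m → suc j *ℕ suc (m +ℕ m) ≡ j *ℕ suc (m +ℕ m) +ℕ suc (m +ℕ m)
    correctionExponent = ℕ-Solver.solve-∀
    identity : ∀ a d o b c x → (a * d) * (o * (b * (1# + c * x))) + (1# + c) * (a * (o * b))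
                               ≈ (a * c) * ((o * (1# + d * x)) * b) + a * (o * ((1# + d) * b))
    identity = solve 6 (λ a d o b c x → (a :* d) :* (o :* (b :* (con 1 :+ c :* x))) :+ (con 1 :+ c) :* (a :* (o :* b))
                                        := (a :* c) :* ((o :* (con 1 :+ d :* x)) :* b) :+ a :* (o :* ((con 1 :+ d) :* b))) ≈-refl

  gaussSum≈prodUpTo*triangularSum : ∀ m → gaussSum m ≈ prodUpTo oddNumber m * triangularSum m
  gaussSum≈prodUpTo*triangularSum zero = begin
    0# + q^ 0 * (1# * 1#) ≈⟨ +-identityˡ (q^ 0 * (1# * 1#)) ⟩
    q^ 0 * (1# * 1#)      ≈⟨ *-congˡ {q^ 0} (*-identityˡ 1#) ⟩
    q^ 0 * 1#             ≈⟨ *-identityʳ (q^ 0) ⟩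
    q^ 0                  ≈⟨ +-identityˡ (q^ 0) ⟨
    0# + q^ 0             ≈⟨ *-identityˡ (0# + q^ 0) ⟨
    1# * (0# + q^ 0)      ∎
    where open ≈-Reasoning
  gaussSum≈prodUpTo*triangularSum (suc m) = begin
    gaussSum (suc m)
      ≈⟨ +-moveʳ (∑-telescope-step gaussTerm C (gaussCorrection m) m ≈-refl (λ k k≤m → gaussTerm-step k≤m)) ⟩
    (gaussCorrection m (suc m) + gaussTerm (suc m) (suc m)) + C * gaussSum m
      ≈⟨ +-cong (+-cong (*-cong (q^-≡ (sym (tri-unique (suc (m +ℕ m)) (suc m *ℕ suc (m +ℕ m)) (oddTri m))))
                                (*-prodBetween-self O' evenNumber m))
                        (*-cong (q^-≡ (sym (tri-unique (suc (suc (m +ℕ m))) (suc m *ℕ suc (suc m +ℕ suc m)) (evenTri m))))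
                                (*-prodBetween-self O' evenNumber (suc m))))
                (*-congˡ {C} (gaussSum≈prodUpTo*triangularSum m)) ⟩
    (Y₁ * (O * C) + Y₂ * (O * C)) + C * (O * triangularSum m)
      ≈⟨ collect Y₁ Y₂ O C (triangularSum m) ⟩
    (O * C) * ((triangularSum m + Y₁) + Y₂)
      ≡⟨ cong (O' *_) (triangularSum-suc m) ⟨
    prodUpTo oddNumber (suc m) * triangularSum (suc m) ∎
    where
    open ≈-Reasoning
    O = prodUpTo oddNumber m
    C = 1+q^ suc (m +ℕ m)
    O' = prodUpTo oddNumber (suc m)
    Y₁ = q^ tri (suc (m +ℕ m))
    Y₂ = q^ tri (suc (suc (m +ℕ m)))
    oddTri : ∀ m → suc m *ℕ suc (m +ℕ m) +ℕ suc m *ℕ suc (m +ℕ m) ≡ suc (m +ℕ m) *ℕ suc (suc (m +ℕ m))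
    oddTri = ℕ-Solver.solve-∀
    evenTri : ∀ m → suc m *ℕ suc (suc m +ℕ suc m) +ℕ suc m *ℕ suc (suc m +ℕ suc m)
                    ≡ suc (suc (m +ℕ m)) *ℕ suc (suc (suc (m +ℕ m)))
    evenTri = ℕ-Solver.solve-∀
    collect : ∀ y₁ y₂ o c t → (y₁ * (o * c) + y₂ * (o * c)) + c * (o * t) ≈ (o * c) * ((t + y₁) + y₂)
    collect = solve 5 (λ y₁ y₂ o c t → (y₁ :* (o :* c) :+ y₂ :* (o :* c)) :+ c :* (o :* t)
                                       := (o :* c) :* ((t :+ y₁) :+ y₂)) ≈-refl

  gaussSum≈[≤]prodUpTo : ∀ m → gaussSum m ≈[≤ m +ℕ m ] prodUpTo evenNumber m
  gaussSum≈[≤]prodUpTo m k k≤2m = trans (∑-≈[≤]-head m (m +ℕ m) (gaussTerm m) higherTerms k k≤2m) (at firstTerm k)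
    where
    higherTerms : ∀ j → gaussTerm m (suc j) ≈[≤ m +ℕ m ] 0#
    higherTerms j i i≤2m = q^-*-low (prodUpTo oddNumber (suc j) * prodBetween evenNumber (suc j) m)
      (ℕ.≤-trans (s≤s i≤2m) (ℕ.m≤m+n (suc (m +ℕ m)) (j *ℕ suc (m +ℕ m))))
    firstTerm : gaussTerm m 0 ≈ prodUpTo evenNumber m
    firstTerm = ≈-trans (*-congʳ {1# * prodUpTo evenNumber m} q^0)
                        (≈-trans (*-identityˡ (1# * prodUpTo evenNumber m)) (*-identityˡ (prodUpTo evenNumber m)))

  gauss : ∏1+q^ oddNumber * ∑q^ tri ≈ ∏1+q^ evenNumber
  gauss = coeffwise λ n → begin
    (∏1+q^ oddNumber * ∑q^ tri) n                    ≡⟨ *-coeff-cong n (∏-agrees oddNumber-inflationary n) (∑q^tri-agrees n) ⟩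
    (prodUpTo oddNumber n * triangularSum n) n       ≡⟨ at (gaussSum≈prodUpTo*triangularSum n) n ⟨
    gaussSum n n                                     ≡⟨ gaussSum≈[≤]prodUpTo n n (ℕ.m≤m+n n n) ⟩
    (∏1+q^ evenNumber) n                             ∎
    where
    open ≡-Reasoning
    ∑q^tri-agrees : ∀ n → ∑q^ tri ≈[≤ n ] triangularSum n
    ∑q^tri-agrees n k k≤n = ∑q^-agrees tri-inflationary (n +ℕ n) k (ℕ.≤-trans k≤n (ℕ.m≤m+n n n))

  ∏odd*∏id≈1 : ∏1+q^ oddNumber * ∏1+q^ id ≈ 1#
  ∏odd*∏id≈1 = ≈-sym (*-cancelʳ-unit (∏1+q^ id) refl (begin
    1# * ∏1+q^ id                                ≈⟨ *-identityˡ (∏1+q^ id) ⟩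
    ∏1+q^ id                                     ≈⟨ ∏-split ⟩
    ∏1+q^ oddNumber * ∏1+q^ evenNumber           ≈⟨ *-congˡ {∏1+q^ oddNumber} (∏-double id-inflationary) ⟩
    ∏1+q^ oddNumber * (∏1+q^ id * ∏1+q^ id)      ≈⟨ *-assoc (∏1+q^ oddNumber) (∏1+q^ id) (∏1+q^ id) ⟨
    (∏1+q^ oddNumber * ∏1+q^ id) * ∏1+q^ id      ∎))
    where open ≈-Reasoning

  ∑q^tri≈∏³ : ∑q^ tri ≈ ∏1+q^ id * ∏1+q^ id * ∏1+q^ id
  ∑q^tri≈∏³ = begin
    ∑q^ tri                                      ≈⟨ *-identityʳ (∑q^ tri) ⟨
    ∑q^ tri * 1#                                 ≈⟨ *-congˡ {∑q^ tri} ∏odd*∏id≈1 ⟨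
    ∑q^ tri * (∏1+q^ oddNumber * ∏1+q^ id)       ≈⟨ rearrange (∑q^ tri) (∏1+q^ oddNumber) (∏1+q^ id) ⟩
    (∏1+q^ oddNumber * ∑q^ tri) * ∏1+q^ id       ≈⟨ *-congʳ {∏1+q^ id} gauss ⟩
    ∏1+q^ evenNumber * ∏1+q^ id                  ≈⟨ *-congʳ {∏1+q^ id} (∏-double id-inflationary) ⟩
    ∏1+q^ id * ∏1+q^ id * ∏1+q^ id               ∎
    where
    open ≈-Reasoning
    rearrange : ∀ t o f → t * (o * f) ≈ (o * t) * f
    rearrange = solve 3 (λ t o f → t :* (o :* f) := (o :* t) :* f) ≈-refl

  -- Triangular numbers modulo 3

  tri-unique′ : ∀ k v j (p : ℕ → ℕ)
    → v +ℕ v ≡ p (tri j +ℕ tri j) → p (j *ℕ suc j) ≡ k *ℕ suc k → tri k ≡ v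
  tri-unique′ k v j p 2v≡p[2t] p[j[j+1]]≡k[k+1] =
    tri-unique k v (trans 2v≡p[2t] (trans (cong p (tri-double j)) p[j[j+1]]≡k[k+1]))

  tri-3j : ∀ j → tri (3 *ℕ j) ≡ 3 *ℕ pentagonal⁺ j
  tri-3j j = tri-unique′ (3 *ℕ j) (3 *ℕ pentagonal⁺ j) j (λ d → 6 *ℕ (j *ℕ j) +ℕ 3 *ℕ d)
                         (expand j (tri j)) (collect j)
    where
    expand : ∀ j t → 3 *ℕ (j *ℕ j +ℕ t) +ℕ 3 *ℕ (j *ℕ j +ℕ t) ≡ 6 *ℕ (j *ℕ j) +ℕ 3 *ℕ (t +ℕ t)
    expand = ℕ-Solver.solve-∀
    collect : ∀ j → 6 *ℕ (j *ℕ j) +ℕ 3 *ℕ (j *ℕ suc j) ≡ 3 *ℕ j *ℕ suc (3 *ℕ j)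
    collect = ℕ-Solver.solve-∀

  tri-3j+1 : ∀ j → tri (3 *ℕ j +ℕ 1) ≡ 3 *ℕ (3 *ℕ tri j) +ℕ 1
  tri-3j+1 j = tri-unique′ (3 *ℕ j +ℕ 1) (3 *ℕ (3 *ℕ tri j) +ℕ 1) j (λ d → 9 *ℕ d +ℕ 2) (expand (tri j)) (collect j)
    where
    expand : ∀ t → (3 *ℕ (3 *ℕ t) +ℕ 1) +ℕ (3 *ℕ (3 *ℕ t) +ℕ 1) ≡ 9 *ℕ (t +ℕ t) +ℕ 2
    expand = ℕ-Solver.solve-∀
    collect : ∀ j → 9 *ℕ (j *ℕ suc j) +ℕ 2 ≡ (3 *ℕ j +ℕ 1) *ℕ suc (3 *ℕ j +ℕ 1)
    collect = ℕ-Solver.solve-∀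

  tri-3j+2 : ∀ j → tri (3 *ℕ j +ℕ 2) ≡ 3 *ℕ pentagonal⁻ j
  tri-3j+2 j = tri-unique′ (3 *ℕ j +ℕ 2) (3 *ℕ pentagonal⁻ j) j (λ d → 6 *ℕ (j *ℕ suc j) +ℕ 6 *ℕ suc j +ℕ 3 *ℕ d)
                           (expand j (tri j)) (collect j)
    where
    expand : ∀ j t → 3 *ℕ (j *ℕ suc j +ℕ (t +ℕ suc j)) +ℕ 3 *ℕ (j *ℕ suc j +ℕ (t +ℕ suc j))
                     ≡ 6 *ℕ (j *ℕ suc j) +ℕ 6 *ℕ suc j +ℕ 3 *ℕ (t +ℕ t)
    expand = ℕ-Solver.solve-∀
    collect : ∀ j → 6 *ℕ (j *ℕ suc j) +ℕ 6 *ℕ suc j +ℕ 3 *ℕ (j *ℕ suc j) ≡ (3 *ℕ j +ℕ 2) *ℕ suc (3 *ℕ j +ℕ 2)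
    collect = ℕ-Solver.solve-∀

  residue : ∀ a {r} → r < 3 → (3 *ℕ a +ℕ r) % 3 ≡ r
  residue a {r} r<3 = begin
    (3 *ℕ a +ℕ r) % 3 ≡⟨ cong (_% 3) (swap a r) ⟩
    (r +ℕ a *ℕ 3) % 3 ≡⟨ [m+kn]%n≡m%n r a 3 ⟩
    r % 3             ≡⟨ m<n⇒m%n≡m r<3 ⟩
    r                 ∎
    where
    open ≡-Reasoning
    swap : ∀ a r → 3 *ℕ a +ℕ r ≡ r +ℕ a *ℕ 3
    swap = ℕ-Solver.solve-∀

  residue₀ : ∀ a → (3 *ℕ a) % 3 ≡ 0
  residue₀ a = trans (cong (_% 3) (sym (ℕ.+-identityʳ (3 *ℕ a)))) (residue a (s≤s z≤n))

  ≢-by-residue : ∀ {x y r s} → x % 3 ≡ r → y % 3 ≡ s → r ≢ s → x ≢ y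
  ≢-by-residue x%3≡r y%3≡s r≢s x≡y = r≢s (trans (sym x%3≡r) (trans (cong (_% 3) x≡y) y%3≡s))

  <3*suc : ∀ m {r} → r < 3 → 3 *ℕ m +ℕ r < 3 *ℕ suc m
  <3*suc m r<3 = ℕ.<-≤-trans (ℕ.+-monoʳ-< (3 *ℕ m) r<3) (ℕ.≤-reflexive (trans (ℕ.+-comm (3 *ℕ m) 3) (sym (ℕ.*-suc 3 m))))

  tri-3j-mod3 : ∀ j → tri (3 *ℕ j) % 3 ≡ 0
  tri-3j-mod3 j = trans (cong (_% 3) (tri-3j j)) (residue₀ (pentagonal⁺ j))

  tri-3j+1-mod3 : ∀ j → tri (3 *ℕ j +ℕ 1) % 3 ≡ 1
  tri-3j+1-mod3 j = trans (cong (_% 3) (tri-3j+1 j)) (residue (3 *ℕ tri j) (s≤s (s≤s z≤n)))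

  tri-3j+2-mod3 : ∀ j → tri (3 *ℕ j +ℕ 2) % 3 ≡ 0
  tri-3j+2-mod3 j = trans (cong (_% 3) (tri-3j+2 j)) (residue₀ (pentagonal⁻ j))

  ∑q^tri-dissect : ∀ {i} N → i < 3 *ℕ N
    → (∑q^ tri) i ≡ ((∑[ j < N ] q^ tri (3 *ℕ j)) i xor (∑[ j < N ] q^ tri (3 *ℕ j +ℕ 1)) i)
                    xor (∑[ j < N ] q^ tri (3 *ℕ j +ℕ 2)) i
  ∑q^tri-dissect {i} N i<3N = trans (∑q^-coeff tri-inflationary i<3N) (at (∑-dissect₃ N (λ k → q^ tri k)) i)

  ∑q^tri-3n+2 : ∀ n → (∑q^ tri) (3 *ℕ n +ℕ 2) ≡ false
  ∑q^tri-3n+2 n = trans (∑q^tri-dissect (suc n) (<3*suc n (s≤s (s≤s (s≤s z≤n)))))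
    (cong₂ _xor_ (cong₂ _xor_ (absent {λ j → tri (3 *ℕ j)} tri-3j-mod3 λ ())
                              (absent {λ j → tri (3 *ℕ j +ℕ 1)} tri-3j+1-mod3 λ ()))
                 (absent {λ j → tri (3 *ℕ j +ℕ 2)} tri-3j+2-mod3 λ ()))
    where
    absent : ∀ {e : ℕ → ℕ} {r} → (∀ j → e j % 3 ≡ r) → r ≢ 2 → (∑[ j < suc n ] q^ e j) (3 *ℕ n +ℕ 2) ≡ false
    absent {e} e%3≡r r≢2 = ∑q^-coeff-absent (suc n) {e} λ j → ≢-by-residue (e%3≡r j) (residue n (s≤s (s≤s (s≤s z≤n)))) r≢2

  ∑q^tri-3n : ∀ n → (∑q^ tri) (3 *ℕ n) ≡ (∑q^ pentagonal⁺ + ∑q^ pentagonal⁻) n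
  ∑q^tri-3n n = begin
    (∑q^ tri) (3 *ℕ n)
      ≡⟨ ∑q^tri-dissect (suc n) (ℕ.*-monoʳ-< 3 (ℕ.n<1+n n)) ⟩
    ((∑[ j < suc n ] q^ tri (3 *ℕ j)) (3 *ℕ n) xor (∑[ j < suc n ] q^ tri (3 *ℕ j +ℕ 1)) (3 *ℕ n))
      xor (∑[ j < suc n ] q^ tri (3 *ℕ j +ℕ 2)) (3 *ℕ n)
      ≡⟨ cong₂ _xor_ (cong₂ _xor_ (tripled {λ j → tri (3 *ℕ j)} {pentagonal⁺} tri-3j)
                                   (∑q^-coeff-absent (suc n) {λ j → tri (3 *ℕ j +ℕ 1)} λ j →
                                      ≢-by-residue (tri-3j+1-mod3 j) (residue₀ n) λ ()))
                     (tripled {λ j → tri (3 *ℕ j +ℕ 2)} {pentagonal⁻} tri-3j+2) ⟩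
    ((∑q^ pentagonal⁺) n xor false) xor (∑q^ pentagonal⁻) n
      ≡⟨ cong (_xor (∑q^ pentagonal⁻) n) (xor-identityʳ ((∑q^ pentagonal⁺) n)) ⟩
    (∑q^ pentagonal⁺ + ∑q^ pentagonal⁻) n ∎
    where
    open ≡-Reasoning
    tripled : ∀ {e p : ℕ → ℕ} → (∀ j → e j ≡ 3 *ℕ p j) → (∑[ j < suc n ] q^ e j) (3 *ℕ n) ≡ (∑[ j < suc n ] q^ p j) n
    tripled {e} {p} e≡3p = ∑q^-coeff-cong (suc n) {e} {p} λ j → ≡ᵇ-injective (3 *ℕ_) (ℕ.*-cancelˡ-≡ _ _ 3) {a = p j} n (e≡3p j)

  ∑q^tri-9n+1 : ∀ n → (∑q^ tri) (9 *ℕ n +ℕ 1) ≡ (∑q^ tri) n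
  ∑q^tri-9n+1 n = begin
    (∑q^ tri) (9 *ℕ n +ℕ 1)
      ≡⟨ cong (∑q^ tri) (nine n) ⟩
    (∑q^ tri) i
      ≡⟨ ∑q^tri-dissect (suc (3 *ℕ n)) (<3*suc (3 *ℕ n) (s≤s (s≤s z≤n))) ⟩
    ((∑[ j < suc (3 *ℕ n) ] q^ tri (3 *ℕ j)) i xor (∑[ j < suc (3 *ℕ n) ] q^ tri (3 *ℕ j +ℕ 1)) i)
      xor (∑[ j < suc (3 *ℕ n) ] q^ tri (3 *ℕ j +ℕ 2)) i
      ≡⟨ cong₂ _xor_ (cong₂ _xor_ (absent {λ j → tri (3 *ℕ j)} tri-3j-mod3) shrunk)
                     (absent {λ j → tri (3 *ℕ j +ℕ 2)} tri-3j+2-mod3) ⟩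
    (∑[ j < suc (3 *ℕ n) ] q^ tri j) n xor false
      ≡⟨ xor-identityʳ _ ⟩
    (∑[ j < suc (3 *ℕ n) ] q^ tri j) n
      ≡⟨ ∑q^-coeff tri-inflationary (s≤s (ℕ.m≤n*m n 3)) ⟨
    (∑q^ tri) n ∎
    where
    open ≡-Reasoning
    i = 3 *ℕ (3 *ℕ n) +ℕ 1
    nine : ∀ n → 9 *ℕ n +ℕ 1 ≡ 3 *ℕ (3 *ℕ n) +ℕ 1
    nine = ℕ-Solver.solve-∀
    absent : ∀ {e : ℕ → ℕ} → (∀ j → e j % 3 ≡ 0) → (∑[ j < suc (3 *ℕ n) ] q^ e j) i ≡ false
    absent {e} e%3≡0 = ∑q^-coeff-absent (suc (3 *ℕ n)) {e} λ j → ≢-by-residue (e%3≡0 j) (residue (3 *ℕ n) (s≤s (s≤s z≤n))) λ ()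
    ×9+1-injective : ∀ {a b} → 3 *ℕ (3 *ℕ a) +ℕ 1 ≡ 3 *ℕ (3 *ℕ b) +ℕ 1 → a ≡ b
    ×9+1-injective {a} {b} eq = ℕ.*-cancelˡ-≡ a b 3 (ℕ.*-cancelˡ-≡ (3 *ℕ a) (3 *ℕ b) 3 (ℕ.+-cancelʳ-≡ 1 _ _ eq))
    shrunk : (∑[ j < suc (3 *ℕ n) ] q^ tri (3 *ℕ j +ℕ 1)) i ≡ (∑[ j < suc (3 *ℕ n) ] q^ tri j) n
    shrunk = ∑q^-coeff-cong (suc (3 *ℕ n)) {λ j → tri (3 *ℕ j +ℕ 1)} {tri} λ j →
      ≡ᵇ-injective (λ a → 3 *ℕ (3 *ℕ a) +ℕ 1) ×9+1-injective {a = tri j} n (tri-3j+1 j)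

  -- Reduction of integer series modulo 2

  isOdd : ℕ → Bool
  isOdd zero = false
  isOdd (suc n) = not (isOdd n)

  isOdd-+ : ∀ m n → isOdd (m +ℕ n) ≡ isOdd m xor isOdd n
  isOdd-+ zero n = refl
  isOdd-+ (suc m) n = trans (cong not (isOdd-+ m n)) (not-distribˡ-xor (isOdd m) (isOdd n))

  isOdd-* : ∀ m n → isOdd (m *ℕ n) ≡ isOdd m ∧ isOdd n
  isOdd-* zero n = refl
  isOdd-* (suc m) n = trans (isOdd-+ n (m *ℕ n)) (trans (cong (isOdd n xor_) (isOdd-* m n)) (absorb (isOdd m) (isOdd n)))
    where
    absorb : ∀ a b → b xor (a ∧ b) ≡ not a ∧ b
    absorb false b = xor-identityʳ b
    absorb true b = xor-same b

  isOdd-false⇒2∣ : ∀ n → isOdd n ≡ false → 2 ∣ n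
  isOdd-false⇒2∣ zero _ = divides 0 refl
  isOdd-false⇒2∣ (suc (suc n)) even with isOdd-false⇒2∣ n (trans (sym (not-involutive (isOdd n))) even)
  ... | divides k n≡k*2 = divides (suc k) (cong (suc ∘ suc) n≡k*2)

  parity : ℤ → Bool
  parity x = isOdd ∣ x ∣

  parity-⊖ : ∀ m n → parity (m ⊖ n) ≡ isOdd m xor isOdd n
  parity-⊖ zero zero = refl
  parity-⊖ (suc m) zero = sym (xor-identityʳ _)
  parity-⊖ zero (suc n) = refl
  parity-⊖ (suc m) (suc n) = trans (cong parity (ℤ.[1+m]⊖[1+n]≡m⊖n m n))
                                   (trans (parity-⊖ m n) (sym (xor-annihilates-not (isOdd m) (isOdd n))))

  parity-+ : ∀ x y → parity (x +ℤ y) ≡ parity x xor parity y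
  parity-+ -[1+ m ] -[1+ n ] = trans (not-involutive (isOdd (m +ℕ n)))
                                     (trans (isOdd-+ m n) (sym (xor-annihilates-not (isOdd m) (isOdd n))))
  parity-+ -[1+ m ] (+ n) = trans (parity-⊖ n (suc m)) (xor-comm (isOdd n) (isOdd (suc m)))
  parity-+ (+ m) -[1+ n ] = parity-⊖ m (suc n)
  parity-+ (+ m) (+ n) = isOdd-+ m n

  parity-* : ∀ x y → parity (x *ℤ y) ≡ parity x ∧ parity y
  parity-* x y = trans (cong isOdd (ℤ.abs-* x y)) (isOdd-* ∣ x ∣ ∣ y ∣)

  parity⇒≡[mod2] : ∀ x y → parity x ≡ parity y → x ≡[mod 2 ] y
  parity⇒≡[mod2] x y same = isOdd-false⇒2∣ ∣ x -ℤ y ∣ (begin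
    parity (x +ℤ -ℤ y)       ≡⟨ parity-+ x (-ℤ y) ⟩
    parity x xor parity (-ℤ y) ≡⟨ cong₂ _xor_ same (cong isOdd (ℤ.∣-i∣≡∣i∣ y)) ⟩
    parity y xor parity y    ≡⟨ xor-same (parity y) ⟩
    false                    ∎)
    where open ≡-Reasoning

  reduce : PS → Series
  reduce a n = parity (a n)

  parity-sum : ∀ xs → parity (sumℤ xs) ≡ xorSum (map parity xs)
  parity-sum [] = refl
  parity-sum (x ∷ xs) = trans (parity-+ x (sumℤ xs)) (cong (parity x xor_) (parity-sum xs))

  reduce-⊛ : ∀ a b → reduce (a ⊛ b) ≈ reduce a * reduce b
  reduce-⊛ a b = coeffwise λ n → begin
    parity (sumℤ (map (λ k → a k *ℤ b (n ∸ k)) (upTo (suc n))))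
      ≡⟨ parity-sum (map (λ k → a k *ℤ b (n ∸ k)) (upTo (suc n))) ⟩
    xorSum (map parity (map (λ k → a k *ℤ b (n ∸ k)) (upTo (suc n))))
      ≡⟨ cong xorSum (map-∘ {g = parity} {f = λ k → a k *ℤ b (n ∸ k)} (upTo (suc n))) ⟨
    xorSum (map (λ k → parity (a k *ℤ b (n ∸ k))) (upTo (suc n)))
      ≡⟨ cong xorSum (map-cong (λ k → parity-* (a k) (b (n ∸ k))) (upTo (suc n))) ⟩
    xorSum (map (λ k → reduce a k ∧ reduce b (n ∸ k)) (upTo (suc n)))
      ≡⟨ cong xorSum (map-applyUpTo id (λ k → reduce a k ∧ reduce b (n ∸ k)) (suc n)) ⟩
    (reduce a * reduce b) n ∎
    where open ≡-Reasoning

  reduce-⊛₃ : ∀ a b c → reduce (a ⊛ b ⊛ c) ≈ reduce a * reduce b * reduce c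
  reduce-⊛₃ a b c = ≈-trans (reduce-⊛ (a ⊛ b) c) (*-congʳ {reduce c} (reduce-⊛ a b))

  reduce-factor : ∀ m → reduce (factor (suc m)) ≈ 1+q^ suc m
  reduce-factor m = coeffwise coefficient
    where
    coefficient : ∀ n → reduce (factor (suc m)) n ≡ (1+q^ suc m) n
    coefficient zero = refl
    coefficient (suc n) with suc m ≟ suc n
    ... | yes m≡n = sym (≡ᵇ-true m≡n)
    ... | no m≢n = sym (≡ᵇ-false m≢n)

  reduce-partialProd : ∀ j N → reduce (partialProd (suc j) N) ≈ prodUpTo (suc j *ℕ_) N
  reduce-partialProd j zero = coeffwise λ where
    zero → refl
    (suc n) → refl
  reduce-partialProd j (suc N) =
    ≈-trans (reduce-⊛ (partialProd (suc j) N) (factor (suc j *ℕ suc N)))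
            (*-cong (reduce-partialProd j N) (reduce-factor (N +ℕ j *ℕ suc N)))

  reduce-f : ∀ j → reduce (f (suc j)) ≈ ∏1+q^ (suc j *ℕ_)
  reduce-f j = coeffwise λ n → at (reduce-partialProd j n) n

  ∏-1* : ∏1+q^ (1 *ℕ_) ≈ ∏1+q^ id
  ∏-1* = ∏-cong ℕ.*-identityˡ

  ∏-multiple-double : ∀ j → ∏1+q^ ((suc j +ℕ suc j) *ℕ_) ≈ ∏1+q^ (suc j *ℕ_) * ∏1+q^ (suc j *ℕ_)
  ∏-multiple-double j = ≈-trans (∏-cong λ i → ℕ.*-distribʳ-+ i (suc j) (suc j)) (∏-double λ i → ℕ.m≤n*m i (suc j))

  quotient≈∑q^tri : ∀ p
    → p * (∏1+q^ (1 *ℕ_) * ∏1+q^ (4 *ℕ_) * ∏1+q^ (4 *ℕ_)) ≈ ∏1+q^ (2 *ℕ_) * ∏1+q^ (2 *ℕ_) * ∏1+q^ (8 *ℕ_)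
    → p ≈ ∑q^ tri
  quotient≈∑q^tri p p*f₁f₄²≈f₂²f₈ =
    ≈-trans (*-cancelʳ-unit (f₁ * f₄ * f₄) refl (≈-trans p*f₁f₄²≈f₂²f₈ (≈-sym f₁³*f₁f₄²≈f₂²f₈)))
            (≈-sym (≈-trans ∑q^tri≈∏³ (*-cong (*-cong (≈-sym ∏-1*) (≈-sym ∏-1*)) (≈-sym ∏-1*))))
    where
    open ≈-Reasoning
    f₁ f₂ f₄ f₈ : Series
    f₁ = ∏1+q^ (1 *ℕ_)
    f₂ = ∏1+q^ (2 *ℕ_)
    f₄ = ∏1+q^ (4 *ℕ_)
    f₈ = ∏1+q^ (8 *ℕ_)
    f₂≈f₁² : f₂ ≈ f₁ * f₁
    f₂≈f₁² = ∏-multiple-double 0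
    f₄≈f₁⁴ : f₄ ≈ (f₁ * f₁) * (f₁ * f₁)
    f₄≈f₁⁴ = ≈-trans (∏-multiple-double 1) (*-cong f₂≈f₁² f₂≈f₁²)
    f₈≈f₁⁸ : f₈ ≈ ((f₁ * f₁) * (f₁ * f₁)) * ((f₁ * f₁) * (f₁ * f₁))
    f₈≈f₁⁸ = ≈-trans (∏-multiple-double 3) (*-cong f₄≈f₁⁴ f₄≈f₁⁴)
    twelve : ∀ a → (a * a * a) * (a * ((a * a) * (a * a)) * ((a * a) * (a * a)))
                   ≈ (a * a) * (a * a) * (((a * a) * (a * a)) * ((a * a) * (a * a)))
    twelve = solve 1 (λ a → (a :* a :* a) :* (a :* ((a :* a) :* (a :* a)) :* ((a :* a) :* (a :* a)))
                            := (a :* a) :* (a :* a) :* (((a :* a) :* (a :* a)) :* ((a :* a) :* (a :* a)))) ≈-refl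
    f₁³*f₁f₄²≈f₂²f₈ : (f₁ * f₁ * f₁) * (f₁ * f₄ * f₄) ≈ f₂ * f₂ * f₈
    f₁³*f₁f₄²≈f₂²f₈ = begin
      (f₁ * f₁ * f₁) * (f₁ * f₄ * f₄)
        ≈⟨ *-congˡ {f₁ * f₁ * f₁} (*-cong (*-congˡ {f₁} f₄≈f₁⁴) f₄≈f₁⁴) ⟩
      (f₁ * f₁ * f₁) * (f₁ * ((f₁ * f₁) * (f₁ * f₁)) * ((f₁ * f₁) * (f₁ * f₁)))
        ≈⟨ twelve f₁ ⟩
      (f₁ * f₁) * (f₁ * f₁) * (((f₁ * f₁) * (f₁ * f₁)) * ((f₁ * f₁) * (f₁ * f₁)))
        ≈⟨ *-cong (*-cong f₂≈f₁² f₂≈f₁²) f₈≈f₁⁸ ⟨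
      f₂ * f₂ * f₈ ∎

  reduce-pod : ∀ pod2 → (∀ n → (pod2 ⊛ (f 1 ⊛ f 4 ⊛ f 4)) n ≡ (f 2 ⊛ f 2 ⊛ f 8) n) → reduce pod2 ≈ ∑q^ tri
  reduce-pod pod2 generatingFunction = quotient≈∑q^tri (reduce pod2) (begin
    reduce pod2 * (∏1+q^ (1 *ℕ_) * ∏1+q^ (4 *ℕ_) * ∏1+q^ (4 *ℕ_))
      ≈⟨ *-congˡ {reduce pod2} (*-cong (*-cong (reduce-f 0) (reduce-f 3)) (reduce-f 3)) ⟨
    reduce pod2 * (reduce (f 1) * reduce (f 4) * reduce (f 4))
      ≈⟨ ≈-trans (reduce-⊛ pod2 (f 1 ⊛ f 4 ⊛ f 4)) (*-congˡ {reduce pod2} (reduce-⊛₃ (f 1) (f 4) (f 4))) ⟨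
    reduce (pod2 ⊛ (f 1 ⊛ f 4 ⊛ f 4))
      ≈⟨ coeffwise (λ n → cong parity (generatingFunction n)) ⟩
    reduce (f 2 ⊛ f 2 ⊛ f 8)
      ≈⟨ reduce-⊛₃ (f 2) (f 2) (f 8) ⟩
    reduce (f 2) * reduce (f 2) * reduce (f 8)
      ≈⟨ *-cong (*-cong (reduce-f 1) (reduce-f 1)) (reduce-f 7) ⟩
    ∏1+q^ (2 *ℕ_) * ∏1+q^ (2 *ℕ_) * ∏1+q^ (8 *ℕ_) ∎)
    where open ≈-Reasoning

  reduce-f₁ : reduce (f 1) ≈ ∑q^ pentagonal⁺ + ∑q^ pentagonal⁻
  reduce-f₁ = ≈-trans (reduce-f 0) (≈-trans ∏-1* euler)

  reduce-f₁³ : reduce (f 1 ⊛ f 1 ⊛ f 1) ≈ ∑q^ tri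
  reduce-f₁³ = ≈-trans (reduce-⊛₃ (f 1) (f 1) (f 1))
                       (≈-trans (*-cong (*-cong f₁≈ f₁≈) f₁≈) (≈-sym ∑q^tri≈∏³))
    where
    f₁≈ : reduce (f 1) ≈ ∏1+q^ id
    f₁≈ = ≈-trans (reduce-f 0) ∏-1*


open PowerSeriesMod2
  using ( at; reduce; ∑q^_; tri; parity⇒≡[mod2]; reduce-pod; reduce-f₁; reduce-f₁³
        ; ∑q^tri-3n+2; ∑q^tri-3n; ∑q^tri-9n+1)

open import Data.Nat using (ℕ; _+_; _*_; _≥_)
open import Data.Integer using (ℤ; +_)
open import Data.Product using (_×_; _,_)
open import Relation.Binary.PropositionalEquality using (_≡_; sym; trans)

theorem1p1 : (pod2 : ℕ → ℤ)
    → (∀ n → (pod2 ⊛ (f 1 ⊛ f 4 ⊛ f 4)) n ≡ (f 2 ⊛ f 2 ⊛ f 8) n)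
    → (∀ n → n ≥ 1 → pod2 (3 * n + 2) ≡[mod 2 ] (+ 0))
    × (∀ n → pod2 (3 * n) ≡[mod 2 ] f 1 n)
    × (∀ n → pod2 (9 * n + 1) ≡[mod 2 ] (f 1 ⊛ f 1 ⊛ f 1) n)
theorem1p1 pod2 generatingFunction =
    -- the congruence at 3n + 2 holds for n = 0 as well
    (λ n _ → parity⇒≡[mod2] (pod2 (3 * n + 2)) (+ 0) (trans (pod₂≡ψ (3 * n + 2)) (∑q^tri-3n+2 n)))
  , (λ n → parity⇒≡[mod2] (pod2 (3 * n)) (f 1 n)
             (trans (pod₂≡ψ (3 * n)) (trans (∑q^tri-3n n) (sym (at reduce-f₁ n)))))
  , (λ n → parity⇒≡[mod2] (pod2 (9 * n + 1)) ((f 1 ⊛ f 1 ⊛ f 1) n)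
             (trans (pod₂≡ψ (9 * n + 1)) (trans (∑q^tri-9n+1 n) (sym (at reduce-f₁³ n)))))
  where
  pod₂≡ψ : ∀ n → reduce pod2 n ≡ (∑q^ tri) n
  pod₂≡ψ = at (reduce-pod pod2 generatingFunction)
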